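{- For $n\ge 2$, the number $\kappa_n$ of connected permutations of $\{1,\ldots,n\}$ is $$\kappa_n=\sum_{k=1}^{n-1}\sum_{1= i_1<i_2<\cdots<i_{k+1}=n}\prod_{j=1}^k (i_{j+1}-i_j-1)!\cdot i_j.$$
   Context: A permutation $\pi\in S_n$ is connected (indecomposable) if there is no $m<n$ with $\pi(\{1,\ldots,m\})=\{1,\ldots,m\}$. -}

module Defs where

open import Data.Nat using (ℕ; zero; suc; _+_; _*_; _∸_; _<_; _≤_; _!; _≟_)
open import Data.Fin using (Fin; toℕ; inject₁) renaming (suc to fsuc)
open import Data.Vec using (Vec; []; _∷_; lookup; head; last; toList)
open import Data.List using (List; []; _∷_; map; concatMap; filter; length; applyUpTo; allFin)
open import Data.Nat.ListAction using (sum; product)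
open import Data.List.Membership.Propositional using (_∈_)
open import Data.List.Relation.Unary.Unique.Propositional using (Unique)
open import Data.List.Relation.Unary.Linked using (Linked)
import Data.List.Relation.Unary.Linked as L
open import Data.Product using (Σ; ∃; _×_; _,_)
open import Function.Definitions using (Injective)
open import Relation.Binary.PropositionalEquality using (_≡_)
open import Relation.Nullary using (¬_; Dec)
open import Relation.Nullary.Decidable using (_×-dec_)
import Data.Nat.Properties as ℕP

Card : ∀ {a p} {A : Set a} → (A → Set p) → ℕ → Set _
Card {A = A} P k =
  Σ (List A) λ xs →
    Unique xs × (∀ x → x ∈ xs → P x) × (∀ x → P x → x ∈ xs) × length xs ≡ k

-- Permutations of {1..n}, represented (0-based) as a vector v : Vec (Fin n) n,
-- i.e. the map π = lookup v : Fin n → Fin n (π(i) = v[i]).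

IsPermutation : ∀ {n} → Vec (Fin n) n → Set
IsPermutation v =
  Injective _≡_ _≡_ (lookup v) × (∀ y → ∃ λ x → lookup v x ≡ y)

-- π({1..m}) = {1..m}   (0-based: {i : toℕ i < m})
FixesPrefix : ∀ {n} → Vec (Fin n) n → ℕ → Set
FixesPrefix v m =
  (∀ i → toℕ i < m → toℕ (lookup v i) < m) ×
  (∀ j → toℕ j < m → ∃ λ i → toℕ i < m × lookup v i ≡ j)

Connected : ∀ {n} → Vec (Fin n) n → Set
Connected {n} v = ∀ m → 1 ≤ m → m < n → ¬ FixesPrefix v m

vecsOf : ∀ {A : Set} (l : ℕ) → List A → List (Vec A l)
vecsOf zero    xs = [] ∷ []
vecsOf (suc l) xs = concatMap (λ x → map (x ∷_) (vecsOf l xs)) xs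

IsChain : (k n : ℕ) → Vec ℕ (suc k) → Set
IsChain k n i = (head i ≡ 1 × last i ≡ n) × Linked _<_ (toList i)

isChain? : (k n : ℕ) → (i : Vec ℕ (suc k)) → Dec (IsChain k n i)
isChain? k n i = ((head i ≟ 1) ×-dec (last i ≟ n)) ×-dec L.linked? ℕP._<?_ (toList i)

chains : (k n : ℕ) → List (Vec ℕ (suc k))
chains k n = filter (isChain? k n) (vecsOf (suc k) (applyUpTo suc n))

weight : (k : ℕ) → Vec ℕ (suc k) → ℕ
weight k i = product (map (λ j → ((lookup i (fsuc j) ∸ lookup i (inject₁ j) ∸ 1) !) * lookup i (inject₁ j)) (allFin k))

rhs : ℕ → ℕ
rhs n = sum (map (λ k → sum (map (weight k) (chains k n))) (applyUpTo suc (n ∸ 1)))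

module Submission where

-- The first block of a permutation π of {1..s} is the least c ≥ 1 with
-- π({1..c}) = {1..c}; π is connected iff its first block is all of {1..s}.
-- Every permutation of size s+1 arises exactly once by inserting the new maximum
-- into a permutation σ of size s at some position p.  If σ has first block c,
-- inserting at one of the c positions inside it yields a connected permutation,
-- and inserting at one of the s+1−c positions after it keeps the first block c.
-- Enumerating permutations by first block along these insertions shows that
-- κ_c · (s−c)! permutations of size s have first block c, where κ₁ = 1 and
-- κ_b = Σ_{c<b} κ_c · step(c,b), step(c,b) = [c<b] · (b−c−1)! · c.
-- On the other side, the k-step chain sums of the theorem are the entries (1,n)
-- of the k-th power of the matrix step; peeling off the last step instead of the
-- first (A^{k+1} = A^k · A) shows that their total κ_b obeys the same recursion.

open import Defs
open import Data.Nat using (ℕ; zero; suc; _+_; _*_; _∸_; _≤_; _<_; z≤n; s≤s; s≤s⁻¹; _!; _≟_; _<?_; _≤?_; _<ᵇ_; _⊓_)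
open import Data.Nat.Properties
open import Data.Nat.Induction using (<-rec)
open import Data.Nat.Tactic.RingSolver using (solve-∀)
open import Data.Bool using (Bool; true; false; if_then_else_; _∧_)
open import Data.Fin using (Fin; toℕ; fromℕ; inject₁; lower₁; punchIn; punchOut) renaming (zero to fzero; suc to fsuc)
open import Data.Fin.Properties using (toℕ-injective; toℕ-fromℕ; toℕ-inject₁; inject₁-injective; fromℕ≢inject₁; toℕ-lower₁; inject₁-lower₁; punchIn-injective; punchInᵢ≢i; punchIn-punchOut; all?; any?; toℕ<n) renaming (_≟_ to _≟ᶠ_)
open import Data.Vec as Vec using (Vec; []; _∷_; lookup; insertAt)
open import Data.Vec.Properties using (insertAt-lookup; insertAt-punchIn; lookup-map; lookup∘tabulate)
open import Data.Vec.Relation.Binary.Pointwise.Extensional using (ext; Pointwise-≡⇒≡)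
open import Data.List as List using (List; []; _∷_; length; map; filter; concatMap; applyUpTo; allFin)
open import Data.Nat.ListAction using (sum; product)
open import Data.Nat.ListAction.Properties using (sum-++)
open import Data.List.Properties using (map-tabulate; map-cong; map-∘; map-++; length-map; length-tabulate; length-++)
open import Data.List.Membership.Propositional using (_∈_; find; lose)
open import Data.List.Membership.Propositional.Properties using (∈-map⁺; ∈-map⁻; ∈-concatMap⁺; ∈-concatMap⁻; ∈-filter⁺; ∈-filter⁻; ∈-allFin; ∈-applyUpTo⁺; ∈-applyUpTo⁻)
open import Data.List.Relation.Unary.Any using (here; there)
open import Data.List.Relation.Unary.All as All using ()
open import Data.List.Relation.Unary.AllPairs using (_∷_; [])
open import Data.List.Relation.Unary.Linked using (linked?)
open import Data.List.Relation.Unary.Unique.Propositional using (Unique)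
import Data.List.Relation.Unary.Unique.Propositional.Properties as Unique
open import Data.Product using (∃; ∃₂; _×_; _,_; proj₁; proj₂)
open import Data.Sum using (_⊎_; inj₁; inj₂)
open import Data.Empty using (⊥-elim)
open import Function using (_∘_)
open import Relation.Nullary using (¬_; Dec; yes; no; does; ¬?; contradiction)
open import Relation.Nullary.Decidable using (_×-dec_; _→-dec_; dec-true; dec-false)
open import Relation.Unary using (Decidable)
open import Algebra.Properties.Semiring.Sum +-*-semiring using (sum-cong-≗; sum-replicate-zero; sum-init-last; ∑-comm; *-distribˡ-sum; *-distribʳ-sum) renaming (sum to ∑)
open import Relation.Binary.PropositionalEquality
open import Relation.Binary.Definitions using (tri<; tri≈; tri>)

Enumerates : {A : Set} → (A → Set) → List A → Set
Enumerates P xs = Unique xs × (∀ x → x ∈ xs → P x) × (∀ x → P x → x ∈ xs)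

enumeration⇒card : ∀ {A : Set} {P : A → Set} {xs} → Enumerates P xs → Card P (length xs)
enumeration⇒card {xs = xs} (unique , sound , complete) = xs , unique , sound , complete , refl

enum-cong : ∀ {A : Set} {P Q : A → Set} {xs} →
  (∀ x → P x → Q x) → (∀ x → Q x → P x) → Enumerates P xs → Enumerates Q xs
enum-cong P⇒Q Q⇒P (unique , sound , complete) =
  unique , (λ x x∈ → P⇒Q x (sound x x∈)) , (λ x qx → complete x (Q⇒P x qx))

enum-[] : ∀ {A : Set} {P : A → Set} → (∀ x → ¬ P x) → Enumerates P []
enum-[] ¬P = [] , (λ _ ()) , (λ x px → contradiction px (¬P x))

enum-singleton : ∀ {A : Set} (a : A) → Enumerates (a ≡_) (a ∷ [])
enum-singleton a = All.[] ∷ [] , (λ { _ (here refl) → refl }) , (λ { _ refl → here refl })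

enum-filter-allFin : ∀ {n} {P : Fin n → Set} (P? : Decidable P) → Enumerates P (filter P? (allFin n))
enum-filter-allFin P? =
  Unique.filter⁺ P? (Unique.allFin⁺ _) ,
  (λ x x∈ → proj₂ (∈-filter⁻ P? {xs = allFin _} x∈)) ,
  (λ x px → ∈-filter⁺ P? (∈-allFin x) px)

enum-range : ∀ n → Enumerates (λ c → 1 ≤ c × c ≤ n) (applyUpTo suc n)
enum-range n =
  Unique.applyUpTo⁺₁ suc n (λ i<j _ → <⇒≢ i<j ∘ suc-injective) ,
  (λ c c∈ → in-range (∈-applyUpTo⁻ suc c∈)) ,
  (λ { (suc i) (_ , i<n) → ∈-applyUpTo⁺ suc i<n })
  where
  in-range : ∀ {c} → ∃ (λ i → i < n × c ≡ suc i) → 1 ≤ c × c ≤ n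
  in-range (i , i<n , refl) = s≤s z≤n , i<n

enum-map : ∀ {A B : Set} {P : A → Set} {xs} (f : A → B) → (∀ {x y} → f x ≡ f y → x ≡ y) →
  Enumerates P xs → Enumerates (λ y → ∃ λ x → P x × f x ≡ y) (map f xs)
enum-map f f-inj (unique , sound , complete) =
  Unique.map⁺ f-inj unique ,
  (λ y y∈ → let x , x∈ , y≡fx = ∈-map⁻ f y∈ in x , sound x x∈ , sym y≡fx) ,
  (λ { _ (x , px , refl) → ∈-map⁺ f (complete x px) })

enum-concatMap : ∀ {A B : Set} {P : A → Set} {Q : A → B → Set} {xs} (g : A → List B) →
  Enumerates P xs → (∀ x → Enumerates (Q x) (g x)) →
  (∀ {x x' y} → P x → P x' → Q x y → Q x' y → x ≡ x') →
  Enumerates (λ y → ∃ λ x → P x × Q x y) (concatMap g xs)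
enum-concatMap {P = P} {Q} {xs} g (unique , sound , complete) family disjoint =
  unique-concatMap xs unique (λ x x∈ → sound x x∈) ,
  (λ y y∈ → let x , x∈ , y∈gx = find (∈-concatMap⁻ g y∈) in x , sound x x∈ , proj₁ (proj₂ (family x)) y y∈gx) ,
  (λ { y (x , px , qxy) → ∈-concatMap⁺ g (lose (complete x px) (proj₂ (proj₂ (family x)) y qxy)) })
  where
  unique-concatMap : ∀ zs → Unique zs → (∀ z → z ∈ zs → P z) → Unique (concatMap g zs)
  unique-concatMap [] _ _ = []
  unique-concatMap (z ∷ zs) (z∉zs ∷ unique-zs) P-zs =
    Unique.++⁺ (proj₁ (family z)) (unique-concatMap zs unique-zs (λ w w∈ → P-zs w (there w∈))) apart
    where
    apart : ∀ {y} → ¬ (y ∈ g z × y ∈ concatMap g zs)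
    apart (y∈gz , y∈rest) =
      let w , w∈ , y∈gw = find (∈-concatMap⁻ g y∈rest)
          Q-z = proj₁ (proj₂ (family z)) _ y∈gz
          Q-w = proj₁ (proj₂ (family w)) _ y∈gw
      in All.lookup z∉zs w∈ (disjoint (P-zs z (here refl)) (P-zs w (there w∈)) Q-z Q-w)

length-concatMap : ∀ {A B : Set} (g : A → List B) xs → length (concatMap g xs) ≡ sum (map (length ∘ g) xs)
length-concatMap g [] = refl
length-concatMap g (x ∷ xs) = trans (length-++ (g x)) (cong (length (g x) +_) (length-concatMap g xs))

sum-const : ∀ {A : Set} (xs : List A) k → sum (map (λ _ → k) xs) ≡ length xs * k
sum-const [] k = refl
sum-const (x ∷ xs) k = cong (k +_) (sum-const xs k)

by-cases : ∀ {A D : Set} (Q : A → Set) (d : Dec D) {x y : A} →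
  (D → Q x) → (¬ D → Q y) → Q (if does d then x else y)
by-cases Q (yes d) yes-case _ = yes-case d
by-cases Q (no ¬d) _ no-case = no-case ¬d

positionsBelow positionsFrom : ∀ n → ℕ → List (Fin n)
positionsBelow n c = filter (λ p → toℕ p <? c) (allFin n)
positionsFrom  n c = filter (λ p → ¬? (toℕ p <? c)) (allFin n)

private
  tabulate-fsuc : ∀ n → List.tabulate {n = n} fsuc ≡ map fsuc (allFin n)
  tabulate-fsuc n = sym (map-tabulate (λ i → i) fsuc)

  below-shift : ∀ {n} c (ps : List (Fin n)) →
    length (filter (λ p → toℕ p <? suc c) (map fsuc ps)) ≡ length (filter (λ p → toℕ p <? c) ps)
  below-shift c [] = refl
  below-shift c (p ∷ ps) with toℕ p <ᵇ c
  ... | true  = cong suc (below-shift c ps)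
  ... | false = below-shift c ps

  from-shift : ∀ {n} c (ps : List (Fin n)) →
    length (filter (λ p → ¬? (toℕ p <? suc c)) (map fsuc ps)) ≡ length (filter (λ p → ¬? (toℕ p <? c)) ps)
  from-shift c [] = refl
  from-shift c (p ∷ ps) with toℕ p <ᵇ c
  ... | true  = from-shift c ps
  ... | false = cong suc (from-shift c ps)

  below-zero : ∀ {n} (ps : List (Fin n)) → length (filter (λ p → toℕ p <? 0) ps) ≡ 0
  below-zero [] = refl
  below-zero (p ∷ ps) = below-zero ps

  from-zero : ∀ {n} (ps : List (Fin n)) → length (filter (λ p → ¬? (toℕ p <? 0)) ps) ≡ length ps
  from-zero [] = refl
  from-zero (p ∷ ps) = cong suc (from-zero ps)

positionsBelow-enumerates : ∀ n c → Enumerates (λ p → toℕ p < c) (positionsBelow n c)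
positionsBelow-enumerates n c = enum-filter-allFin (λ p → toℕ p <? c)

positionsFrom-enumerates : ∀ n c → Enumerates (λ p → ¬ toℕ p < c) (positionsFrom n c)
positionsFrom-enumerates n c = enum-filter-allFin (λ p → ¬? (toℕ p <? c))

length-positionsBelow : ∀ n c → length (positionsBelow n c) ≡ n ⊓ c
length-positionsBelow zero    c       = refl
length-positionsBelow (suc n) zero    = below-zero (allFin (suc n))
length-positionsBelow (suc n) (suc c) = cong suc (begin
  length (filter (λ p → toℕ p <? suc c) (List.tabulate {n = n} fsuc))
    ≡⟨ cong (λ ps → length (filter (λ p → toℕ p <? suc c) ps)) (tabulate-fsuc n) ⟩
  length (filter (λ p → toℕ p <? suc c) (map fsuc (allFin n)))
    ≡⟨ below-shift c (allFin n) ⟩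
  length (positionsBelow n c)
    ≡⟨ length-positionsBelow n c ⟩
  n ⊓ c ∎)
  where open ≡-Reasoning

length-positionsFrom : ∀ n c → length (positionsFrom n c) ≡ n ∸ c
length-positionsFrom zero    c       = sym (0∸n≡0 c)
length-positionsFrom (suc n) zero    = trans (from-zero (allFin (suc n))) (length-tabulate (λ i → i))
length-positionsFrom (suc n) (suc c) = begin
  length (filter (λ p → ¬? (toℕ p <? suc c)) (List.tabulate {n = n} fsuc))
    ≡⟨ cong (λ ps → length (filter (λ p → ¬? (toℕ p <? suc c)) ps)) (tabulate-fsuc n) ⟩
  length (filter (λ p → ¬? (toℕ p <? suc c)) (map fsuc (allFin n)))
    ≡⟨ from-shift c (allFin n) ⟩
  length (positionsFrom n c)
    ≡⟨ length-positionsFrom n c ⟩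
  n ∸ c ∎
  where open ≡-Reasoning

insertMax : ∀ {n} → Vec (Fin n) n → Fin (suc n) → Vec (Fin (suc n)) (suc n)
insertMax {n} σ p = insertAt (Vec.map inject₁ σ) p (fromℕ n)

module _ {n} (σ : Vec (Fin n) n) (p : Fin (suc n)) where

  insertMax-at : lookup (insertMax σ p) p ≡ fromℕ n
  insertMax-at = insertAt-lookup _ p _

  insertMax-punchIn : ∀ j → lookup (insertMax σ p) (punchIn p j) ≡ inject₁ (lookup σ j)
  insertMax-punchIn j = trans (insertAt-punchIn _ p _ j) (lookup-map j inject₁ σ)

  toℕ-insertMax-punchIn : ∀ j → toℕ (lookup (insertMax σ p) (punchIn p j)) ≡ toℕ (lookup σ j)
  toℕ-insertMax-punchIn j = trans (cong toℕ (insertMax-punchIn j)) (toℕ-inject₁ _)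

position-view : ∀ {n} (p i : Fin (suc n)) → i ≡ p ⊎ ∃ λ j → punchIn p j ≡ i
position-view p i with i ≟ᶠ p
... | yes i≡p = inj₁ i≡p
... | no  i≢p = inj₂ (punchOut (i≢p ∘ sym) , punchIn-punchOut (i≢p ∘ sym))

punchIn-below : ∀ {n} (p : Fin (suc n)) (j : Fin n) → toℕ j < toℕ p → toℕ (punchIn p j) ≡ toℕ j
punchIn-below (fsuc p) fzero    _   = refl
punchIn-below (fsuc p) (fsuc j) j<p = cong suc (punchIn-below p j (s≤s⁻¹ j<p))

punchIn-below⁻ : ∀ {n} (p : Fin (suc n)) (j : Fin n) → toℕ (punchIn p j) < toℕ p → toℕ (punchIn p j) ≡ toℕ j
punchIn-below⁻ (fsuc p) fzero    _   = refl
punchIn-below⁻ (fsuc p) (fsuc j) j<p = cong suc (punchIn-below⁻ p j (s≤s⁻¹ j<p))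

insertMax-permutation : ∀ {n} (σ : Vec (Fin n) n) p → IsPermutation σ → IsPermutation (insertMax σ p)
insertMax-permutation {n} σ p (σ-inj , σ-surj) = injective , surjective
  where
  injective : ∀ {a b} → lookup (insertMax σ p) a ≡ lookup (insertMax σ p) b → a ≡ b
  injective {a} {b} eq with position-view p a | position-view p b
  ... | inj₁ refl       | inj₁ refl       = refl
  ... | inj₁ refl       | inj₂ (j , refl) =
    ⊥-elim (fromℕ≢inject₁ (trans (sym (insertMax-at σ p)) (trans eq (insertMax-punchIn σ p j))))
  ... | inj₂ (j , refl) | inj₁ refl       =
    ⊥-elim (fromℕ≢inject₁ (trans (sym (insertMax-at σ p)) (trans (sym eq) (insertMax-punchIn σ p j))))
  ... | inj₂ (j , refl) | inj₂ (k , refl) =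
    cong (punchIn p) (σ-inj (inject₁-injective
      (trans (sym (insertMax-punchIn σ p j)) (trans eq (insertMax-punchIn σ p k)))))
  surjective : ∀ y → ∃ λ x → lookup (insertMax σ p) x ≡ y
  surjective y with toℕ y ≟ n
  ... | yes y≡n = p , trans (insertMax-at σ p) (toℕ-injective (trans (toℕ-fromℕ n) (sym y≡n)))
  ... | no  y≢n = let j , σj≡y = σ-surj (lower₁ y (y≢n ∘ sym)) in
    punchIn p j , trans (insertMax-punchIn σ p j) (trans (cong inject₁ σj≡y) (inject₁-lower₁ y _))

insertMax-injective : ∀ {n} (σ σ' : Vec (Fin n) n) p p' → insertMax σ p ≡ insertMax σ' p' → σ ≡ σ' × p ≡ p'
insertMax-injective σ σ' p p' eq = Pointwise-≡⇒≡ (ext same-values) , p≡p'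
  where
  p≡p' : p ≡ p'
  p≡p' with position-view p p'
  ... | inj₁ p'≡p = sym p'≡p
  ... | inj₂ (j , refl) = ⊥-elim (fromℕ≢inject₁
        (trans (sym (insertMax-at σ' (punchIn p j)))
               (trans (cong (λ v → lookup v (punchIn p j)) (sym eq)) (insertMax-punchIn σ p j))))
  same-values : ∀ j → lookup σ j ≡ lookup σ' j
  same-values j = inject₁-injective
    (trans (sym (insertMax-punchIn σ p' j))
           (trans (cong (λ q → lookup (insertMax σ q) (punchIn p' j)) (sym p≡p'))
                  (trans (cong (λ v → lookup v (punchIn p' j)) eq) (insertMax-punchIn σ' p' j))))

-- Every permutation of size n+1 arises by inserting the maximum n into a
-- permutation of size n: delete n from π and re-insert it where it was.
insertMax-surjective : ∀ {n} (π : Vec (Fin (suc n)) (suc n)) → IsPermutation π →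
  ∃₂ λ σ p → IsPermutation σ × insertMax σ p ≡ π
insertMax-surjective {n} π (π-inj , π-surj) = σ , p , (σ-inj , σ-surj) , Pointwise-≡⇒≡ (ext reinsert)
  where
  p = proj₁ (π-surj (fromℕ n))
  πp≡n = proj₂ (π-surj (fromℕ n))
  not-max : ∀ j → n ≢ toℕ (lookup π (punchIn p j))
  not-max j eq = punchInᵢ≢i p j (π-inj (trans (toℕ-injective (trans (sym eq) (sym (toℕ-fromℕ n)))) (sym πp≡n)))
  σ : Vec (Fin n) n
  σ = Vec.tabulate (λ j → lower₁ (lookup π (punchIn p j)) (not-max j))
  σ-values : ∀ j → inject₁ (lookup σ j) ≡ lookup π (punchIn p j)
  σ-values j = trans (cong inject₁ (lookup∘tabulate _ j)) (inject₁-lower₁ _ _)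
  σ-inj : ∀ {j k} → lookup σ j ≡ lookup σ k → j ≡ k
  σ-inj {j} {k} eq = punchIn-injective p j k (π-inj (trans (sym (σ-values j)) (trans (cong inject₁ eq) (σ-values k))))
  σ-surj : ∀ y → ∃ λ x → lookup σ x ≡ y
  σ-surj y with π-surj (inject₁ y)
  ... | x , πx≡y with position-view p x
  ...   | inj₁ refl = ⊥-elim (fromℕ≢inject₁ (trans (sym πp≡n) πx≡y))
  ...   | inj₂ (j , refl) = j , inject₁-injective (trans (σ-values j) πx≡y)
  reinsert : ∀ i → lookup (insertMax σ p) i ≡ lookup π i
  reinsert i with position-view p i
  ... | inj₁ refl = trans (insertMax-at σ p) (sym πp≡n)
  ... | inj₂ (j , refl) = trans (insertMax-punchIn σ p j) (σ-values j)

module _ {n} (σ : Vec (Fin n) n) (p : Fin (suc n)) where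

  fixesPrefix-insertMax⁻ : ∀ {m} → m ≤ toℕ p → FixesPrefix (insertMax σ p) m → FixesPrefix σ m
  fixesPrefix-insertMax⁻ {m} m≤p (closed , onto) = closed′ , onto′
    where
    closed′ : ∀ j → toℕ j < m → toℕ (lookup σ j) < m
    closed′ j j<m = subst (_< m) (toℕ-insertMax-punchIn σ p j)
      (closed (punchIn p j) (subst (_< m) (sym (punchIn-below p j (<-≤-trans j<m m≤p))) j<m))
    onto′ : ∀ y → toℕ y < m → ∃ λ j → toℕ j < m × lookup σ j ≡ y
    onto′ y y<m with onto (inject₁ y) (subst (_< m) (sym (toℕ-inject₁ y)) y<m)
    ... | i , i<m , πi≡y with position-view p i
    ...   | inj₁ refl = contradiction m≤p (<⇒≱ i<m)
    ...   | inj₂ (j , refl) = j , subst (_< m) (punchIn-below⁻ p j (<-≤-trans i<m m≤p)) i<m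
                                , inject₁-injective (trans (sym (insertMax-punchIn σ p j)) πi≡y)

  fixesPrefix-insertMax⁺ : ∀ {m} → m ≤ toℕ p → FixesPrefix σ m → FixesPrefix (insertMax σ p) m
  fixesPrefix-insertMax⁺ {m} m≤p (closed , onto) = closed′ , onto′
    where
    closed′ : ∀ i → toℕ i < m → toℕ (lookup (insertMax σ p) i) < m
    closed′ i i<m with position-view p i
    ... | inj₁ refl = contradiction m≤p (<⇒≱ i<m)
    ... | inj₂ (j , refl) = subst (_< m) (sym (toℕ-insertMax-punchIn σ p j))
                              (closed j (subst (_< m) (punchIn-below⁻ p j (<-≤-trans i<m m≤p)) i<m))
    onto′ : ∀ y → toℕ y < m → ∃ λ i → toℕ i < m × lookup (insertMax σ p) i ≡ y
    onto′ y y<m =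
      punchIn p j , subst (_< m) (sym (punchIn-below p j (<-≤-trans j<m m≤p))) j<m ,
      trans (insertMax-punchIn σ p j) (trans (cong inject₁ σj≡y) (inject₁-lower₁ y y≢n))
      where
      y≢n : n ≢ toℕ y
      y≢n n≡y = <⇒≢ (<-≤-trans y<m (≤-trans m≤p (s≤s⁻¹ (toℕ<n p)))) (sym n≡y)
      preimage = onto (lower₁ y y≢n) (subst (_< m) (sym (toℕ-lower₁ y y≢n)) y<m)
      j = proj₁ preimage
      j<m = proj₁ (proj₂ preimage)
      σj≡y = proj₂ (proj₂ preimage)

  -- A proper prefix containing the insertion point p contains the value n,
  -- which lies outside it.
  fixesPrefix-insertMax-¬ : ∀ {m} → toℕ p < m → m ≤ n → ¬ FixesPrefix (insertMax σ p) m
  fixesPrefix-insertMax-¬ {m} p<m m≤n (closed , _) =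
    <⇒≱ (subst (_< m) (trans (cong toℕ (insertMax-at σ p)) (toℕ-fromℕ n)) (closed p p<m)) m≤n

FirstBlock : ∀ {n} → Vec (Fin n) n → ℕ → Set
FirstBlock v c = 1 ≤ c × FixesPrefix v c × (∀ m → 1 ≤ m → m < c → ¬ FixesPrefix v m)

firstBlock-unique : ∀ {n} (v : Vec (Fin n) n) {c c'} → FirstBlock v c → FirstBlock v c' → c ≡ c'
firstBlock-unique _ {c} {c'} (1≤c , fix , least) (1≤c' , fix' , least') with <-cmp c c'
... | tri< c<c' _ _ = contradiction fix (least' c 1≤c c<c')
... | tri≈ _ c≡c' _ = c≡c'
... | tri> _ _ c'<c = contradiction fix' (least c' 1≤c' c'<c)

fixesPrefix? : ∀ {n} (v : Vec (Fin n) n) m → Dec (FixesPrefix v m)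
fixesPrefix? v m =
  all? (λ i → (toℕ i <? m) →-dec (toℕ (lookup v i) <? m)) ×-dec
  all? (λ y → (toℕ y <? m) →-dec any? (λ i → (toℕ i <? m) ×-dec (lookup v i ≟ᶠ y)))

permutation-fixesAll : ∀ {n} (v : Vec (Fin n) n) → IsPermutation v → FixesPrefix v n
permutation-fixesAll v (_ , surj) =
  (λ i _ → toℕ<n (lookup v i)) , (λ y _ → proj₁ (surj y) , toℕ<n _ , proj₂ (surj y))

least-witness : ∀ {P : ℕ → Set} → (∀ m → Dec (P m)) → ∀ m → P m → ∃ λ k → P k × (∀ j → j < k → ¬ P j)
least-witness {P} P? = <-rec (λ m → P m → ∃ λ k → P k × (∀ j → j < k → ¬ P j)) search
  where
  search : ∀ m → (∀ {j} → j < m → P j → ∃ λ k → P k × (∀ i → i < k → ¬ P i)) →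
           P m → ∃ λ k → P k × (∀ i → i < k → ¬ P i)
  search m smaller pm with anyUpTo? P? m
  ... | yes (j , j<m , pj) = smaller j<m pj
  ... | no  none = m , pm , λ j j<m pj → none (j , j<m , pj)

-- A permutation of positive size has a first block: the least positive prefix
-- that is a block, the whole range being one.
firstBlock-exists : ∀ {n} (v : Vec (Fin (suc n)) (suc n)) → IsPermutation v →
  ∃ λ c → c ≤ suc n × FirstBlock v c
firstBlock-exists {n} v perm with least-witness (λ m → (1 ≤? m) ×-dec fixesPrefix? v m) (suc n)
                                                  (s≤s z≤n , permutation-fixesAll v perm)
... | c , (1≤c , fix) , below =
  c , ≮⇒≥ (λ n<c → below (suc n) n<c (s≤s z≤n , permutation-fixesAll v perm)) ,
  1≤c , fix , λ m 1≤m m<c fix-m → below m m<c (1≤m , fix-m)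

connected⇒firstBlock : ∀ {n} (v : Vec (Fin n) n) → 1 ≤ n → IsPermutation v → Connected v → FirstBlock v n
connected⇒firstBlock v 1≤n perm conn = 1≤n , permutation-fixesAll v perm , conn

firstBlock⇒connected : ∀ {n} (v : Vec (Fin n) n) → FirstBlock v n → Connected v
firstBlock⇒connected v (_ , _ , least) = least

firstBlock-insertBelow : ∀ {n} (σ : Vec (Fin n) n) p {c} → IsPermutation σ → FirstBlock σ c → toℕ p < c →
  FirstBlock (insertMax σ p) (suc n)
firstBlock-insertBelow {n} σ p perm (_ , _ , least) p<c =
  s≤s z≤n , permutation-fixesAll (insertMax σ p) (insertMax-permutation σ p perm) , no-smaller
  where
  no-smaller : ∀ m → 1 ≤ m → m < suc n → ¬ FixesPrefix (insertMax σ p) m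
  no-smaller m 1≤m m≤n fix with m ≤? toℕ p
  ... | yes m≤p = least m 1≤m (≤-<-trans m≤p p<c) (fixesPrefix-insertMax⁻ σ p m≤p fix)
  ... | no  m≰p = fixesPrefix-insertMax-¬ σ p (≰⇒> m≰p) (s≤s⁻¹ m≤n) fix

firstBlock-insertFrom : ∀ {n} (σ : Vec (Fin n) n) p {c} → FirstBlock σ c → c ≤ toℕ p →
  FirstBlock (insertMax σ p) c
firstBlock-insertFrom σ p (1≤c , fix , least) c≤p =
  1≤c , fixesPrefix-insertMax⁺ σ p c≤p fix ,
  λ m 1≤m m<c fix-m → least m 1≤m m<c (fixesPrefix-insertMax⁻ σ p (≤-trans (<⇒≤ m<c) c≤p) fix-m)

insertAll : ∀ {n} → List (Vec (Fin n) n) → List (Fin (suc n)) → List (Vec (Fin (suc n)) (suc n))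
insertAll σs ps = concatMap (λ σ → map (insertMax σ) ps) σs

-- Distinct pairs (σ, p) give distinct insertions, so enumerations combine.
insertAll-enumerates : ∀ {n} {P : Vec (Fin n) n → Set} {Q : Fin (suc n) → Set} {σs ps} →
  Enumerates P σs → Enumerates Q ps →
  Enumerates (λ π → ∃ λ σ → P σ × ∃ λ p → Q p × insertMax σ p ≡ π) (insertAll σs ps)
insertAll-enumerates {ps = ps} σs-enum ps-enum =
  enum-concatMap (λ σ → map (insertMax σ) ps) σs-enum
    (λ σ → enum-map (insertMax σ) (λ eq → proj₂ (insertMax-injective σ σ _ _ eq)) ps-enum)
    (λ { _ _ (p , _ , refl) (p' , _ , eq) → proj₁ (insertMax-injective _ _ p p' (sym eq)) })

length-insertAll : ∀ {n} (σs : List (Vec (Fin n) n)) ps → length (insertAll σs ps) ≡ length σs * length ps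
length-insertAll σs ps = trans (length-concatMap (λ σ → map (insertMax σ) ps) σs)
  (trans (cong sum (map-cong (λ σ → length-map (insertMax σ) ps) σs)) (sum-const σs (length ps)))

WithFirstBlock : ∀ {n} → ℕ → Vec (Fin n) n → Set
WithFirstBlock c v = IsPermutation v × FirstBlock v c

-- firstBlockPerms s c lists the permutations of size s+1 with first block c:
-- the new connected ones come from insertions inside the first block of a
-- smaller permutation, the others from insertions after it.
mutual
  firstBlockPerms : (s : ℕ) → ℕ → List (Vec (Fin (suc s)) (suc s))
  firstBlockPerms zero    c = if does (c ≟ 1) then (fzero ∷ []) ∷ [] else []
  firstBlockPerms (suc s) c =
    if does (c ≟ suc (suc s)) then connectedPerms s
    else insertAll (firstBlockPerms s c) (positionsFrom (suc (suc s)) c)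

  connectedPerms : (s : ℕ) → List (Vec (Fin (suc (suc s))) (suc (suc s)))
  connectedPerms s =
    concatMap (λ c → insertAll (firstBlockPerms s c) (positionsBelow (suc (suc s)) c)) (applyUpTo suc (suc s))

withFirstBlock-one : WithFirstBlock 1 (fzero ∷ [])
withFirstBlock-one =
  ((λ { {fzero} {fzero} _ → refl }) , (λ { fzero → fzero , refl })) ,
  ≤-refl , ((λ { fzero _ → s≤s z≤n }) , (λ { fzero _ → fzero , s≤s z≤n , refl })) , (λ m 1≤m m<1 _ → <⇒≱ m<1 1≤m)

insertion-view : ∀ {s} (π : Vec (Fin (suc (suc s))) (suc (suc s))) → IsPermutation π →
  ∃₂ λ σ p → ∃ λ c → WithFirstBlock c σ × c ≤ suc s × insertMax σ p ≡ π
insertion-view π perm with insertMax-surjective π perm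
... | σ , p , σ-perm , refl with firstBlock-exists σ σ-perm
...   | c , c≤ , fb = σ , p , c , (σ-perm , fb) , c≤ , refl

module _ {s} (π : Vec (Fin (suc (suc s))) (suc (suc s))) where

  connected-view : WithFirstBlock (suc (suc s)) π →
    ∃ λ c → (1 ≤ c × c ≤ suc s) × ∃ λ σ → WithFirstBlock c σ × ∃ λ p → toℕ p < c × insertMax σ p ≡ π
  connected-view (perm , fb) with insertion-view π perm
  ... | σ , p , c , (σ-perm , σ-fb) , c≤ , refl with toℕ p <? c
  ...   | yes p<c = c , (proj₁ σ-fb , c≤) , σ , (σ-perm , σ-fb) , p , p<c , refl
  ...   | no  p≮c = contradiction (firstBlock-unique π (firstBlock-insertFrom σ p σ-fb (≮⇒≥ p≮c)) fb)
                                  (<⇒≢ (s≤s c≤))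

  connected-view⁻ : ∃ (λ c → (1 ≤ c × c ≤ suc s) × ∃ λ σ → WithFirstBlock c σ × ∃ λ p → toℕ p < c × insertMax σ p ≡ π) →
    WithFirstBlock (suc (suc s)) π
  connected-view⁻ (c , _ , σ , (σ-perm , σ-fb) , p , p<c , refl) =
    insertMax-permutation σ p σ-perm , firstBlock-insertBelow σ p σ-perm σ-fb p<c

  extended-view : ∀ {c} → c ≢ suc (suc s) → WithFirstBlock c π →
    ∃ λ σ → WithFirstBlock c σ × ∃ λ p → ¬ toℕ p < c × insertMax σ p ≡ π
  extended-view {c} c≢ (perm , fb) with insertion-view π perm
  ... | σ , p , c' , (σ-perm , σ-fb) , _ , refl with toℕ p <? c'
  ...   | yes p<c' = contradiction (firstBlock-unique π fb (firstBlock-insertBelow σ p σ-perm σ-fb p<c')) c≢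
  ...   | no  p≮c' with firstBlock-unique π fb (firstBlock-insertFrom σ p σ-fb (≮⇒≥ p≮c'))
  ...     | refl = σ , (σ-perm , σ-fb) , p , p≮c' , refl

  extended-view⁻ : ∀ {c} → ∃ (λ σ → WithFirstBlock c σ × ∃ λ p → ¬ toℕ p < c × insertMax σ p ≡ π) →
    WithFirstBlock c π
  extended-view⁻ (σ , (σ-perm , σ-fb) , p , p≮c , refl) =
    insertMax-permutation σ p σ-perm , firstBlock-insertFrom σ p σ-fb (≮⇒≥ p≮c)

firstBlockPerms-enumerates : ∀ s c → Enumerates (WithFirstBlock c) (firstBlockPerms s c)
firstBlockPerms-enumerates zero c = by-cases (Enumerates (WithFirstBlock c)) (c ≟ 1)
  (λ { refl → enum-cong (λ { _ refl → withFirstBlock-one }) (λ { (fzero ∷ []) _ → refl })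
                        (enum-singleton (fzero ∷ [])) })
  (λ c≢1 → enum-[] (λ { (fzero ∷ []) (_ , fb) → c≢1 (firstBlock-unique (fzero ∷ []) fb (proj₂ withFirstBlock-one)) }))
firstBlockPerms-enumerates (suc s) c = by-cases (Enumerates (WithFirstBlock c)) (c ≟ suc (suc s))
  (λ { refl → enum-cong (λ π → connected-view⁻ π) (λ π → connected-view π)
                (enum-concatMap _ (enum-range (suc s))
                  (λ c' → insertAll-enumerates (firstBlockPerms-enumerates s c') (positionsBelow-enumerates _ c'))
                  same-block) })
  (λ c≢ → enum-cong (λ π → extended-view⁻ π) (λ π → extended-view π c≢)
            (insertAll-enumerates (firstBlockPerms-enumerates s c) (positionsFrom-enumerates _ c)))
  where
  -- an insertion determines σ, and σ determines its first block
  same-block : ∀ {c c'} {π : Vec (Fin (suc (suc s))) (suc (suc s))} → 1 ≤ c × c ≤ suc s → 1 ≤ c' × c' ≤ suc s →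
    (∃ λ σ → WithFirstBlock c σ × ∃ λ p → toℕ p < c × insertMax σ p ≡ π) →
    (∃ λ σ → WithFirstBlock c' σ × ∃ λ p → toℕ p < c' × insertMax σ p ≡ π) → c ≡ c'
  same-block _ _ (σ , (_ , fb) , p , _ , refl) (σ' , (_ , fb') , p' , _ , eq)
    with insertMax-injective σ σ' p p' (sym eq)
  ... | refl , _ = firstBlock-unique σ fb fb'

opaque
  Σ< : ℕ → (ℕ → ℕ) → ℕ
  Σ< n f = ∑ {n} (λ i → f (toℕ i))

  Σ<-zero-length : ∀ (f : ℕ → ℕ) → Σ< 0 f ≡ 0
  Σ<-zero-length f = refl

  Σ<-suc : ∀ n (f : ℕ → ℕ) → Σ< (suc n) f ≡ f 0 + Σ< n (f ∘ suc)
  Σ<-suc n f = refl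

  Σ<-last : ∀ n (f : ℕ → ℕ) → Σ< (suc n) f ≡ Σ< n f + f n
  Σ<-last n f = trans (sum-init-last {n} (λ i → f (toℕ i)))
    (cong₂ _+_ (sum-cong-≗ {n} (λ i → cong f (toℕ-inject₁ i))) (cong f (toℕ-fromℕ n)))

  Σ<-cong : ∀ n {f g : ℕ → ℕ} → (∀ i → i < n → f i ≡ g i) → Σ< n f ≡ Σ< n g
  Σ<-cong n f≡g = sum-cong-≗ {n} (λ i → f≡g (toℕ i) (toℕ<n i))

  Σ<-zero : ∀ n {f : ℕ → ℕ} → (∀ i → i < n → f i ≡ 0) → Σ< n f ≡ 0
  Σ<-zero n f≡0 = trans (Σ<-cong n f≡0) (sum-replicate-zero n)

  Σ<-swap : ∀ m n (f : ℕ → ℕ → ℕ) → Σ< m (λ i → Σ< n (f i)) ≡ Σ< n (λ j → Σ< m (λ i → f i j))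
  Σ<-swap m n f = ∑-comm {m} {n} (λ i j → f (toℕ i) (toℕ j))

  Σ<-*ˡ : ∀ n x (f : ℕ → ℕ) → x * Σ< n f ≡ Σ< n (λ i → x * f i)
  Σ<-*ˡ n x f = *-distribˡ-sum {n} x (λ i → f (toℕ i))

  Σ<-*ʳ : ∀ n x (f : ℕ → ℕ) → Σ< n f * x ≡ Σ< n (λ i → f i * x)
  Σ<-*ʳ n x f = *-distribʳ-sum {n} x (λ i → f (toℕ i))

Σ<-truncate : ∀ {M b} (f : ℕ → ℕ) → b ≤ M → (∀ z → b ≤ z → z < M → f z ≡ 0) → Σ< M f ≡ Σ< b f
Σ<-truncate {zero} f z≤n _ = refl
Σ<-truncate {suc M} {b} f b≤M vanish with m≤n⇒m<n∨m≡n b≤M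
... | inj₂ refl = refl
... | inj₁ b<M = begin
  Σ< (suc M) f  ≡⟨ Σ<-last M f ⟩
  Σ< M f + f M  ≡⟨ cong₂ _+_ (Σ<-truncate f (s≤s⁻¹ b<M) (λ z b≤z z<M → vanish z b≤z (m<n⇒m<1+n z<M)))
                            (vanish M (s≤s⁻¹ b<M) ≤-refl) ⟩
  Σ< b f + 0    ≡⟨ +-identityʳ _ ⟩
  Σ< b f        ∎
  where open ≡-Reasoning

Σ<-single : ∀ {M b} (f : ℕ → ℕ) → b < M → (∀ z → z ≢ b → f z ≡ 0) → Σ< M f ≡ f b
Σ<-single {M} {b} f b<M vanish = begin
  Σ< M f        ≡⟨ Σ<-truncate f b<M (λ z b<z _ → vanish z (λ z≡b → <⇒≢ b<z (sym z≡b))) ⟩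
  Σ< (suc b) f  ≡⟨ Σ<-last b f ⟩
  Σ< b f + f b  ≡⟨ cong (_+ f b) (Σ<-zero b (λ z z<b → vanish z (<⇒≢ z<b))) ⟩
  f b           ∎
  where open ≡-Reasoning

sum-applyUpTo : ∀ {A : Set} k (f : ℕ → A) (g : A → ℕ) → sum (map g (applyUpTo f k)) ≡ Σ< k (g ∘ f)
sum-applyUpTo zero    f g = sym (Σ<-zero-length (g ∘ f))
sum-applyUpTo (suc k) f g = trans (cong (g (f 0) +_) (sum-applyUpTo k (f ∘ suc) g)) (sym (Σ<-suc k (g ∘ f)))

⟦_⟧ : Bool → ℕ
⟦ true  ⟧ = 1
⟦ false ⟧ = 0

⟦∧⟧ : ∀ a b → ⟦ a ∧ b ⟧ ≡ ⟦ a ⟧ * ⟦ b ⟧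
⟦∧⟧ true  b = sym (+-identityʳ ⟦ b ⟧)
⟦∧⟧ false b = refl

⟦≟⟧-refl : ∀ x → ⟦ does (x ≟ x) ⟧ ≡ 1
⟦≟⟧-refl x = cong ⟦_⟧ (dec-true (x ≟ x) refl)

⟦≟⟧-≢ : ∀ {x y} → x ≢ y → ⟦ does (x ≟ y) ⟧ ≡ 0
⟦≟⟧-≢ {x} {y} x≢y = cong ⟦_⟧ (dec-false (x ≟ y) x≢y)

step : ℕ → ℕ → ℕ
step x y = ⟦ does (x <? y) ⟧ * ((y ∸ x ∸ 1) ! * x)

step-< : ∀ {x y} → x < y → step x y ≡ (y ∸ x ∸ 1) ! * x
step-< {x} {y} x<y = trans (cong (λ b → ⟦ b ⟧ * ((y ∸ x ∸ 1) ! * x)) (dec-true (x <? y) x<y)) (*-identityˡ _)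

step-≥ : ∀ {x y} → y ≤ x → step x y ≡ 0
step-≥ {x} {y} y≤x = cong (λ b → ⟦ b ⟧ * ((y ∸ x ∸ 1) ! * x)) (dec-false (x <? y) (≤⇒≯ y≤x))

-- Walks with all nodes below M.  In matrix terms, walks k is the k-th power of
-- the step matrix restricted to {0..M−1}.
module Walks (M : ℕ) where

  -- total weight of the chains x = i₀ < i₁ < ⋯ < i_k = b
  walks : ℕ → ℕ → ℕ → ℕ
  walks zero    x b = ⟦ does (x ≟ b) ⟧
  walks (suc k) x b = Σ< M (λ y → step x y * walks k y b)

  -- A chain of k steps climbs at least k.
  walks-short : ∀ k x b → b < x + k → walks k x b ≡ 0
  walks-short zero    x b b<x+0 = ⟦≟⟧-≢ (λ x≡b → <⇒≢ (subst (b <_) (+-identityʳ x) b<x+0) (sym x≡b))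
  walks-short (suc k) x b b<x+1+k = Σ<-zero M term-vanishes
    where
    term-vanishes : ∀ y → y < M → step x y * walks k y b ≡ 0
    term-vanishes y _ with x <? y
    ... | yes x<y = trans (cong (step x y *_) (walks-short k y b
                      (<-≤-trans b<x+1+k (≤-trans (≤-reflexive (+-suc x k)) (+-monoˡ-≤ k x<y)))))
                      (*-zeroʳ (step x y))
    ... | no  x≮y = cong (_* walks k y b) (step-≥ (≮⇒≥ x≮y))

  walks-last : ∀ k x b → x < M → b < M → walks (suc k) x b ≡ Σ< M (λ z → walks k x z * step z b)
  walks-last zero x b x<M b<M = begin
    Σ< M (λ y → step x y * ⟦ does (y ≟ b) ⟧)
      ≡⟨ Σ<-single _ b<M (λ y y≢b → trans (cong (step x y *_) (⟦≟⟧-≢ y≢b)) (*-zeroʳ (step x y))) ⟩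
    step x b * ⟦ does (b ≟ b) ⟧
      ≡⟨ trans (cong (step x b *_) (⟦≟⟧-refl b)) (*-identityʳ _) ⟩
    step x b
      ≡˘⟨ trans (cong (_* step x b) (⟦≟⟧-refl x)) (*-identityˡ _) ⟩
    ⟦ does (x ≟ x) ⟧ * step x b
      ≡˘⟨ Σ<-single (λ z → ⟦ does (x ≟ z) ⟧ * step z b) x<M
                 (λ z z≢x → cong (_* step z b) (⟦≟⟧-≢ (z≢x ∘ sym))) ⟩
    Σ< M (λ z → ⟦ does (x ≟ z) ⟧ * step z b) ∎
    where open ≡-Reasoning
  walks-last (suc k) x b x<M b<M = begin
    Σ< M (λ y → step x y * walks (suc k) y b)
      ≡⟨ Σ<-cong M (λ y y<M → cong (step x y *_) (walks-last k y b y<M b<M)) ⟩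
    Σ< M (λ y → step x y * Σ< M (λ z → walks k y z * step z b))
      ≡⟨ Σ<-cong M (λ y _ → Σ<-*ˡ M (step x y) _) ⟩
    Σ< M (λ y → Σ< M (λ z → step x y * (walks k y z * step z b)))
      ≡⟨ Σ<-swap M M _ ⟩
    Σ< M (λ z → Σ< M (λ y → step x y * (walks k y z * step z b)))
      ≡⟨ Σ<-cong M (λ z _ → trans (Σ<-cong M (λ y _ → sym (*-assoc (step x y) _ _)))
                                  (sym (Σ<-*ʳ M (step z b) _))) ⟩
    Σ< M (λ z → walks (suc k) x z * step z b) ∎
    where open ≡-Reasoning

  -- κ b: total weight of all chains from 1 to b (they have fewer than b steps).
  κ : ℕ → ℕ
  κ b = Σ< b (λ k → walks k 1 b)

  κ-one : κ 1 ≡ 1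
  κ-one = trans (Σ<-suc 0 _) (cong (1 +_) (Σ<-zero-length _))

  -- Conditioning on the last step:  κ_b = Σ_{c<b} κ_c · step(c, b).
  κ-rec : ∀ b → 2 ≤ b → b < M → κ b ≡ Σ< b (λ c → κ c * step c b)
  κ-rec (suc zero)    (s≤s ()) _
  κ-rec (suc (suc b)) _ b<M = begin
    κ (2 + b)
      ≡⟨ Σ<-suc (suc b) _ ⟩
    Σ< (suc b) (λ k → walks (suc k) 1 (2 + b))
      ≡⟨ Σ<-cong (suc b) (λ k _ → walks-last k 1 (2 + b) (<-trans (s≤s (s≤s z≤n)) b<M) b<M) ⟩
    Σ< (suc b) (λ k → Σ< M (λ c → walks k 1 c * step c (2 + b)))
      ≡⟨ Σ<-swap (suc b) M _ ⟩
    Σ< M (λ c → Σ< (suc b) (λ k → walks k 1 c * step c (2 + b)))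
      ≡⟨ Σ<-cong M (λ c _ → sym (Σ<-*ʳ (suc b) (step c (2 + b)) _)) ⟩
    Σ< M (λ c → Σ< (suc b) (λ k → walks k 1 c) * step c (2 + b))
      ≡⟨ Σ<-truncate _ (<⇒≤ b<M) (λ c b≤c _ → trans (cong (Σ< (suc b) (λ k → walks k 1 c) *_) (step-≥ b≤c)) (*-zeroʳ (Σ< (suc b) (λ k → walks k 1 c)))) ⟩
    Σ< (2 + b) (λ c → Σ< (suc b) (λ k → walks k 1 c) * step c (2 + b))
      ≡⟨ Σ<-cong (2 + b) (λ c c<b → cong (_* step c (2 + b))
           (Σ<-truncate _ (s≤s⁻¹ c<b) (λ k c≤k _ → walks-short k 1 c (s≤s c≤k)))) ⟩
    Σ< (2 + b) (λ c → κ c * step c (2 + b)) ∎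
    where open ≡-Reasoning

module Counting (M : ℕ) where
  open Walks M

  factorial-step : ∀ a m → a * m ! * suc m ≡ a * (suc m) !
  factorial-step a m = trans (*-assoc a (m !) (suc m)) (cong (a *_) (*-comm (m !) (suc m)))

  length-firstBlockPerms : ∀ s c → 1 ≤ c → c ≤ suc s → suc s < M →
    length (firstBlockPerms s c) ≡ κ c * (suc s ∸ c) !
  length-firstBlockPerms zero (suc zero) _ _ _ = sym (trans (*-identityʳ (κ 1)) κ-one)
  length-firstBlockPerms zero (suc (suc _)) _ (s≤s ()) _
  length-firstBlockPerms (suc s) c 1≤c c≤ s<M =
    by-cases (λ xs → length xs ≡ κ c * (suc (suc s) ∸ c) !) (c ≟ suc (suc s))
      (λ { refl → connected-count })
      (λ c≢ → extended-count (s≤s⁻¹ (≤∧≢⇒< c≤ c≢)))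
    where
    -- Inserting inside a first block of size c' can be done in c' ways, each
    -- contributing step(c', s + 2) after the factor κ_{c'}.
    block-count : ∀ i → i < suc s →
      length (insertAll (firstBlockPerms s (suc i)) (positionsBelow (suc (suc s)) (suc i)))
        ≡ κ (suc i) * step (suc i) (suc (suc s))
    block-count i i<1+s = begin
      length (insertAll (firstBlockPerms s (suc i)) (positionsBelow (suc (suc s)) (suc i)))
        ≡⟨ length-insertAll (firstBlockPerms s (suc i)) (positionsBelow (suc (suc s)) (suc i)) ⟩
      length (firstBlockPerms s (suc i)) * length (positionsBelow (suc (suc s)) (suc i))
        ≡⟨ cong₂ _*_ (length-firstBlockPerms s (suc i) (s≤s z≤n) i<1+s (<-trans (n<1+n (suc s)) s<M))
                     (trans (length-positionsBelow (suc (suc s)) (suc i)) (m≥n⇒m⊓n≡n (m≤n⇒m≤1+n i<1+s))) ⟩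
      κ (suc i) * (s ∸ i) ! * suc i
        ≡⟨ *-assoc (κ (suc i)) ((s ∸ i) !) (suc i) ⟩
      κ (suc i) * ((s ∸ i) ! * suc i)
        ≡˘⟨ cong (κ (suc i) *_) (trans (step-< (s≤s i<1+s))
              (cong (λ m → (m ∸ 1) ! * suc i) (+-∸-assoc 1 (s≤s⁻¹ i<1+s)))) ⟩
      κ (suc i) * step (suc i) (suc (suc s)) ∎
      where open ≡-Reasoning

    connected-count : length (connectedPerms s) ≡ κ (suc (suc s)) * (suc (suc s) ∸ suc (suc s)) !
    connected-count = begin
      length (connectedPerms s)
        ≡⟨ length-concatMap (λ c' → insertAll (firstBlockPerms s c') (positionsBelow (suc (suc s)) c')) (applyUpTo suc (suc s)) ⟩
      sum (map (λ c' → length (insertAll (firstBlockPerms s c') (positionsBelow (suc (suc s)) c'))) (applyUpTo suc (suc s)))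
        ≡⟨ sum-applyUpTo (suc s) suc (λ c' → length (insertAll (firstBlockPerms s c') (positionsBelow (suc (suc s)) c'))) ⟩
      Σ< (suc s) (λ i → length (insertAll (firstBlockPerms s (suc i)) (positionsBelow (suc (suc s)) (suc i))))
        ≡⟨ Σ<-cong (suc s) block-count ⟩
      Σ< (suc s) (λ i → κ (suc i) * step (suc i) (suc (suc s)))
        ≡˘⟨ trans (Σ<-suc (suc s) (λ c' → κ c' * step c' (suc (suc s))))
                  (cong (λ k → k * step 0 (suc (suc s)) + Σ< (suc s) (λ i → κ (suc i) * step (suc i) (suc (suc s)))) (Σ<-zero-length (λ k → walks k 1 0))) ⟩
      Σ< (suc (suc s)) (λ c' → κ c' * step c' (suc (suc s)))
        ≡˘⟨ κ-rec (suc (suc s)) (s≤s (s≤s z≤n)) s<M ⟩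
      κ (suc (suc s))
        ≡˘⟨ trans (cong (λ m → κ (suc (suc s)) * m !) (n∸n≡0 (suc (suc s)))) (*-identityʳ _) ⟩
      κ (suc (suc s)) * (suc (suc s) ∸ suc (suc s)) ! ∎
      where open ≡-Reasoning

    extended-count : c ≤ suc s →
      length (insertAll (firstBlockPerms s c) (positionsFrom (suc (suc s)) c)) ≡ κ c * (suc (suc s) ∸ c) !
    extended-count c≤1+s = begin
      length (insertAll (firstBlockPerms s c) (positionsFrom (suc (suc s)) c))
        ≡⟨ length-insertAll (firstBlockPerms s c) (positionsFrom (suc (suc s)) c) ⟩
      length (firstBlockPerms s c) * length (positionsFrom (suc (suc s)) c)
        ≡⟨ cong₂ _*_ (length-firstBlockPerms s c 1≤c c≤1+s (<-trans (n<1+n (suc s)) s<M))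
                     (trans (length-positionsFrom (suc (suc s)) c) (+-∸-assoc 1 c≤1+s)) ⟩
      κ c * (suc s ∸ c) ! * suc (suc s ∸ c)
        ≡⟨ factorial-step (κ c) (suc s ∸ c) ⟩
      κ c * (suc (suc s ∸ c)) !
        ≡˘⟨ cong (λ m → κ c * m !) (+-∸-assoc 1 c≤1+s) ⟩
      κ c * (suc (suc s) ∸ c) ! ∎
      where open ≡-Reasoning

sum-filter : ∀ {A : Set} {P : A → Set} (P? : Decidable P) (w : A → ℕ) xs →
  sum (map w (filter P? xs)) ≡ sum (map (λ x → ⟦ does (P? x) ⟧ * w x) xs)
sum-filter P? w [] = refl
sum-filter P? w (x ∷ xs) with does (P? x)
... | true  = cong₂ _+_ (sym (+-identityʳ (w x))) (sum-filter P? w xs)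
... | false = sum-filter P? w xs

sum-*ˡ : ∀ {A : Set} c (h : A → ℕ) xs → sum (map (λ x → c * h x) xs) ≡ c * sum (map h xs)
sum-*ˡ c h [] = sym (*-zeroʳ c)
sum-*ˡ c h (x ∷ xs) = trans (cong (c * h x +_) (sum-*ˡ c h xs)) (sym (*-distribˡ-+ c (h x) _))

sum-concatMap : ∀ {A B : Set} (g : B → ℕ) (f : A → List B) xs →
  sum (map g (concatMap f xs)) ≡ sum (map (λ x → sum (map g (f x))) xs)
sum-concatMap g f [] = refl
sum-concatMap g f (x ∷ xs) = begin
  sum (map g (f x List.++ concatMap f xs))              ≡⟨ cong sum (map-++ g (f x) (concatMap f xs)) ⟩
  sum (map g (f x) List.++ map g (concatMap f xs))      ≡⟨ sum-++ (map g (f x)) _ ⟩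
  sum (map g (f x)) + sum (map g (concatMap f xs))      ≡⟨ cong (sum (map g (f x)) +_) (sum-concatMap g f xs) ⟩
  sum (map g (f x)) + sum (map (λ y → sum (map g (f y))) xs) ∎
  where open ≡-Reasoning

sum-vecsOf-suc : ∀ {A : Set} k xs (g : Vec A (suc k) → ℕ) →
  sum (map g (vecsOf (suc k) xs)) ≡ sum (map (λ x → sum (map (λ v → g (x ∷ v)) (vecsOf k xs))) xs)
sum-vecsOf-suc k xs g = trans (sum-concatMap g (λ x → map (x ∷_) (vecsOf k xs)) xs)
  (cong sum (map-cong (λ x → cong sum (sym (map-∘ (vecsOf k xs)))) xs))

weight-cons : ∀ k x y (v : Vec ℕ k) → weight (suc k) (x ∷ y ∷ v) ≡ (y ∸ x ∸ 1) ! * x * weight k (y ∷ v)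
weight-cons k x y v = cong ((y ∸ x ∸ 1) ! * x *_)
  (trans (cong product (map-tabulate {n = k} fsuc factor)) (sym (cong product (map-tabulate {n = k} (λ j → j) factor′))))
  where
  factor : Fin (suc k) → ℕ
  factor j = (lookup (x ∷ y ∷ v) (fsuc j) ∸ lookup (x ∷ y ∷ v) (inject₁ j) ∸ 1) ! * lookup (x ∷ y ∷ v) (inject₁ j)
  factor′ : Fin k → ℕ
  factor′ j = (lookup (y ∷ v) (fsuc j) ∸ lookup (y ∷ v) (inject₁ j) ∸ 1) ! * lookup (y ∷ v) (inject₁ j)

private
  regroup : ∀ l p q a w → l * (p * q) * (a * w) ≡ p * a * (l * q * w)
  regroup = solve-∀

  regroup′ : ∀ h l q w → h * l * q * w ≡ h * (l * q * w)
  regroup′ = solve-∀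

module Chains (n : ℕ) where
  open Walks (suc n)

  R : List ℕ
  R = applyUpTo suc n

  chainWeight : ∀ k → Vec ℕ (suc k) → ℕ
  chainWeight k u = ⟦ does (Vec.last u ≟ n) ⟧ * ⟦ does (linked? _<?_ (Vec.toList u)) ⟧ * weight k u

  chainWeight-cons : ∀ k x y (v : Vec ℕ k) → chainWeight (suc k) (x ∷ y ∷ v) ≡ step x y * chainWeight k (y ∷ v)
  chainWeight-cons k x y v = begin
    ⟦ L ⟧ * ⟦ does (x <? y) ∧ I ⟧ * weight (suc k) (x ∷ y ∷ v)
      ≡⟨ cong₂ (λ a b → ⟦ L ⟧ * a * b) (⟦∧⟧ (does (x <? y)) I) (weight-cons k x y v) ⟩
    ⟦ L ⟧ * (⟦ does (x <? y) ⟧ * ⟦ I ⟧) * ((y ∸ x ∸ 1) ! * x * weight k (y ∷ v))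
      ≡⟨ regroup ⟦ L ⟧ ⟦ does (x <? y) ⟧ ⟦ I ⟧ ((y ∸ x ∸ 1) ! * x) (weight k (y ∷ v)) ⟩
    step x y * chainWeight k (y ∷ v) ∎
    where
    open ≡-Reasoning
    L = does (Vec.last (y ∷ v) ≟ n)
    I = does (linked? _<?_ (Vec.toList (y ∷ v)))

  walks-as-chains : ∀ k x → sum (map (λ v → chainWeight k (x ∷ v)) (vecsOf k R)) ≡ walks k x n
  walks-as-chains zero x = trans (+-identityʳ _) (trans (*-identityʳ _) (*-identityʳ _))
  walks-as-chains (suc k) x = begin
    sum (map (λ v → chainWeight (suc k) (x ∷ v)) (vecsOf (suc k) R))
      ≡⟨ sum-vecsOf-suc k R (λ v → chainWeight (suc k) (x ∷ v)) ⟩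
    sum (map (λ y → sum (map (λ v → chainWeight (suc k) (x ∷ y ∷ v)) (vecsOf k R))) R)
      ≡⟨ cong sum (map-cong (λ y → trans (cong sum (map-cong (chainWeight-cons k x y) (vecsOf k R)))
                                   (trans (sum-*ˡ (step x y) (λ v → chainWeight k (y ∷ v)) (vecsOf k R))
                                          (cong (step x y *_) (walks-as-chains k y)))) R) ⟩
    sum (map (λ y → step x y * walks k y n) R)
      ≡⟨ sum-applyUpTo n suc (λ y → step x y * walks k y n) ⟩
    Σ< n (λ i → step x (suc i) * walks k (suc i) n)
      ≡˘⟨ trans (Σ<-suc n (λ y → step x y * walks k y n))
                (cong (λ a → a * walks k 0 n + Σ< n (λ i → step x (suc i) * walks k (suc i) n)) (step-≥ {x} z≤n)) ⟩
    walks (suc k) x n ∎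
    where open ≡-Reasoning

  chain-sum : ∀ k → 1 ≤ n → sum (map (weight k) (chains k n)) ≡ walks k 1 n
  chain-sum k 1≤n = begin
    sum (map (weight k) (chains k n))
      ≡⟨ sum-filter (isChain? k n) (weight k) (vecsOf (suc k) R) ⟩
    sum (map (λ u → ⟦ does (isChain? k n u) ⟧ * weight k u) (vecsOf (suc k) R))
      ≡⟨ sum-vecsOf-suc k R (λ u → ⟦ does (isChain? k n u) ⟧ * weight k u) ⟩
    sum (map (λ x → sum (map (λ v → ⟦ does (isChain? k n (x ∷ v)) ⟧ * weight k (x ∷ v)) (vecsOf k R))) R)
      ≡⟨ cong sum (map-cong (λ x → trans (cong sum (map-cong (starts-at-one x) (vecsOf k R)))
                                   (trans (sum-*ˡ ⟦ does (x ≟ 1) ⟧ (λ v → chainWeight k (x ∷ v)) (vecsOf k R))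
                                          (cong (⟦ does (x ≟ 1) ⟧ *_) (walks-as-chains k x)))) R) ⟩
    sum (map (λ x → ⟦ does (x ≟ 1) ⟧ * walks k x n) R)
      ≡⟨ sum-applyUpTo n suc (λ x → ⟦ does (x ≟ 1) ⟧ * walks k x n) ⟩
    Σ< n (λ i → ⟦ does (suc i ≟ 1) ⟧ * walks k (suc i) n)
      ≡⟨ Σ<-single _ 1≤n (λ i i≢0 → cong (_* walks k (suc i) n) (⟦≟⟧-≢ (i≢0 ∘ suc-injective))) ⟩
    1 * walks k 1 n
      ≡⟨ *-identityˡ _ ⟩
    walks k 1 n ∎
    where
    open ≡-Reasoning
    starts-at-one : ∀ x (v : Vec ℕ k) →
      ⟦ does (isChain? k n (x ∷ v)) ⟧ * weight k (x ∷ v) ≡ ⟦ does (x ≟ 1) ⟧ * chainWeight k (x ∷ v)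
    starts-at-one x v =
      let H = does (x ≟ 1); L = does (Vec.last (x ∷ v) ≟ n); I = does (linked? _<?_ (Vec.toList (x ∷ v))) in
      trans (cong (_* weight k (x ∷ v)) (trans (⟦∧⟧ (H ∧ L) I) (cong (_* ⟦ I ⟧) (⟦∧⟧ H L))))
            (regroup′ ⟦ H ⟧ ⟦ L ⟧ ⟦ I ⟧ (weight k (x ∷ v)))

rhs≡κ : ∀ s → rhs (suc (suc s)) ≡ Walks.κ (suc (suc (suc s))) (suc (suc s))
rhs≡κ s = begin
  rhs (suc (suc s))
    ≡⟨ sum-applyUpTo (suc s) suc (λ k → sum (map (weight k) (chains k (suc (suc s))))) ⟩
  Σ< (suc s) (λ i → sum (map (weight (suc i)) (chains (suc i) (suc (suc s)))))
    ≡⟨ Σ<-cong (suc s) (λ i _ → chain-sum (suc i) (s≤s z≤n)) ⟩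
  Σ< (suc s) (λ i → walks (suc i) 1 (suc (suc s)))
    ≡˘⟨ Σ<-suc (suc s) (λ k → walks k 1 (suc (suc s))) ⟩
  κ (suc (suc s)) ∎
  where
  open ≡-Reasoning
  open Walks (suc (suc (suc s)))
  open Chains (suc (suc s))

theorem4p7 : (n : ℕ) → 2 ≤ n →
    Card (λ (v : Vec (Fin n) n) → IsPermutation v × Connected v) (rhs n)
theorem4p7 (suc zero) (s≤s ())
theorem4p7 (suc (suc s)) _ = subst (Card (λ v → IsPermutation v × Connected v)) count
  (enumeration⇒card (enum-cong (λ v (perm , fb) → perm , firstBlock⇒connected v fb)
                               (λ v (perm , conn) → perm , connected⇒firstBlock v (s≤s z≤n) perm conn)
                               (firstBlockPerms-enumerates (suc s) n)))
  where
  n = suc (suc s)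
  open Walks (suc n)
  open Counting (suc n)
  count : length (firstBlockPerms (suc s) n) ≡ rhs n
  count = begin
    length (firstBlockPerms (suc s) n) ≡⟨ length-firstBlockPerms (suc s) n (s≤s z≤n) ≤-refl ≤-refl ⟩
    κ n * (n ∸ n) !                   ≡⟨ trans (cong (λ m → κ n * m !) (n∸n≡0 n)) (*-identityʳ (κ n)) ⟩
    κ n                               ≡˘⟨ rhs≡κ s ⟩
    rhs n                             ∎
    where open ≡-Reasoning
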